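{- Let $G$ be a finite simple graph admitting an FTD-code. Then $\gamma^{\mathrm{FTD}}(G)\ge\max(\gamma^{\mathrm{ITD}}(G),\gamma^{\mathrm{OTD}}(G),\gamma^{\mathrm{FD}}(G))$ and $\gamma^{\mathrm{FD}}(G)\ge\max(\gamma^{\mathrm{ID}}(G),\gamma^{\mathrm{OD}}(G),\gamma^{\mathrm{LTD}}(G)-1,\gamma^{\mathrm{ITD}}(G)-1,\gamma^{\mathrm{OTD}}(G)-1)$.
   Context: For a vertex $v$ of $G=(V,E)$, $N(v)$ is its open and $N[v]=N(v)\cup\{v\}$ its closed neighborhood. For $C\subseteq V$: $C$ is dominating if $N[v]\cap C\neq\emptyset$ for all $v\in V$; total-dominating if $N(v)\cap C\neq\emptyset$ for all $v\in V$; closed-separating if the sets $N[v]\cap C$ ($v\in V$) are pairwise distinct; open-separating if the sets $N(v)\cap C$ ($v\in V$) are pairwise distinct; locating if the sets $N(v)\cap C$ ($v\in V\setminus C$) are pairwise distinct; full-separating if for all distinct $u,v$, $(N(v)\cap C)\setminus\{u\}\neq(N(u)\cap C)\setminus\{v\}$. An ID-code is a closed-separating dominating set; ITD-code: closed-separating total-dominating; LTD-code: locating total-dominating; OD-code: open-separating dominating; OTD-code: open-separating total-dominating; FD-code: full-separating dominating; FTD-code: full-separating total-dominating. $\gamma^{X}(G)$ denotes the minimum cardinality of an X-code of $G$. -}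

module Defs where

open import Data.Nat using (ℕ; _≤_)
open import Data.Bool using (Bool; true; false)
open import Data.Fin using (Fin)
open import Data.Fin.Subset using (Subset; _∈_; _∉_; _∩_; _∪_; ⁅_⁆; _-_; ∣_∣; Nonempty)
open import Data.Vec using (tabulate)
open import Data.Product using (Σ; _×_; _,_)
open import Relation.Binary.PropositionalEquality using (_≡_; _≢_)

record Graph (n : ℕ) : Set where
  field
    adj     : Fin n → Fin n → Bool
    adj-sym : ∀ u v → adj u v ≡ adj v u
    adj-irr : ∀ v → adj v v ≡ false
open Graph public

module _ {n : ℕ} (G : Graph n) where
  N : Fin n → Subset n
  N v = tabulate (λ u → adj G v u)

  N[_] : Fin n → Subset n
  N[ v ] = N v ∪ ⁅ v ⁆

  IsDominating : Subset n → Set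
  IsDominating C = ∀ v → Nonempty (N[ v ] ∩ C)

  IsTotalDominating : Subset n → Set
  IsTotalDominating C = ∀ v → Nonempty (N v ∩ C)

  IsClosedSeparating : Subset n → Set
  IsClosedSeparating C = ∀ u v → u ≢ v → N[ u ] ∩ C ≢ N[ v ] ∩ C

  IsOpenSeparating : Subset n → Set
  IsOpenSeparating C = ∀ u v → u ≢ v → N u ∩ C ≢ N v ∩ C

  IsLocating : Subset n → Set
  IsLocating C = ∀ u v → u ∉ C → v ∉ C → u ≢ v → N u ∩ C ≢ N v ∩ C

  IsFullSeparating : Subset n → Set
  IsFullSeparating C = ∀ u v → u ≢ v → (N v ∩ C) - u ≢ (N u ∩ C) - v

data CodeType : Set where
  ID ITD LTD OD OTD FD FTD : CodeType

IsCode : {n : ℕ} → CodeType → Graph n → Subset n → Set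
IsCode ID  G C = IsClosedSeparating G C × IsDominating G C
IsCode ITD G C = IsClosedSeparating G C × IsTotalDominating G C
IsCode LTD G C = IsLocating G C × IsTotalDominating G C
IsCode OD  G C = IsOpenSeparating G C × IsDominating G C
IsCode OTD G C = IsOpenSeparating G C × IsTotalDominating G C
IsCode FD  G C = IsFullSeparating G C × IsDominating G C
IsCode FTD G C = IsFullSeparating G C × IsTotalDominating G C

HasCode : {n : ℕ} → CodeType → Graph n → Set
HasCode X G = Σ (Subset _) (λ C → IsCode X G C)

IsGamma : {n : ℕ} → CodeType → Graph n → ℕ → Set
IsGamma X G k = Σ (Subset _) (λ C → IsCode X G C × ∣ C ∣ ≡ k)
              × (∀ C → IsCode X G C → k ≤ ∣ C ∣)

-- A full-separating set is closed- and open-separating: equal closed (or open) traces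
-- of u and v stay equal after deleting u from one and v from the other, because no
-- vertex is its own neighbour. This gives the first chain of inequalities and
-- γ^FD ≥ γ^ID, γ^OD. Full separation also forbids two vertices u ≠ v with
-- N(u) ∩ C = N(v) ∩ C = ∅, so an FD-code misses total domination at one vertex w at
-- most, which adding a neighbour of w repairs; full separation survives enlarging C.
-- Hence γ^FTD ≤ γ^FD + 1, and the bounds by γ^LTD, γ^ITD, γ^OTD follow.
module Submission where

open import Defs
open import Data.Nat using (ℕ; zero; suc; _≤_; _+_; _∸_; _⊔_; z≤n; s≤s; _≤?_)
open import Data.Nat.Properties
  using ( ≤-refl; ≤-trans; ≤-antisym; ≤-reflexive; ≰⇒>; +-suc; +-monoʳ-≤; m≤m+n; m+n∸n≡m
        ; ∸-monoˡ-≤; ⊔-lub)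
open import Data.Bool using (true; false)
open import Data.Bool.Properties using () renaming (_≟_ to _≟ᵇ_)
open import Data.Fin using (Fin)
open import Data.Fin.Properties using (all?; ¬∀⟶∃¬) renaming (_≟_ to _≟ᶠ_)
open import Data.Fin.Subset
  using (Subset; _∈_; _∉_; _∩_; _∪_; _─_; _-_; ⁅_⁆; ∣_∣; _⊆_; Nonempty; Empty; inside; outside)
open import Data.Fin.Subset.Properties
  using ( _∈?_; ⊆-antisym; x∈p∩q⁺; x∈p∩q⁻; x∈p∪q⁺; x∈p∪q⁻; p⊆p∪q; p─q⊆p; x∈p∧x≢y⇒x∈p-y
        ; p─x─y≡p─y─x; x∈⁅x⁆; x∈⁅y⁆⇒x≡y; x∉⁅y⁆⇒x≢y; ∣⁅x⁆∣≡1; ∣p∣≤∣x∷p∣; Empty-unique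
        ; nonempty?; anySubset?)
open import Data.Vec using ([]; _∷_; here; there)
open import Data.Vec.Properties using (lookup∘tabulate; []=⇒lookup; ≡-dec)
open import Data.Product using (Σ; ∃; _×_; _,_; proj₁; proj₂; map₁; map₂)
open import Data.Sum using (inj₁; inj₂)
open import Function using (_∘_)
open import Relation.Binary.PropositionalEquality
  using (_≡_; _≢_; refl; sym; trans; cong; subst; module ≡-Reasoning)
open import Relation.Nullary using (Dec; yes; no; contradiction)
open import Relation.Nullary.Decidable using (¬?; _×-dec_; _→-dec_; decidable-stable)
open import Relation.Unary using (Decidable)

open ≡-Reasoning

private
  variable
    n : ℕ

x∈p─q⇒x∉q : ∀ {x : Fin n} (p q : Subset n) → x ∈ p ─ q → x ∉ q
x∈p─q⇒x∉q (_ ∷ p) (inside  ∷ q) ()        here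
x∈p─q⇒x∉q (_ ∷ p) (outside ∷ q) here      ()
x∈p─q⇒x∉q (_ ∷ p) (_       ∷ q) (there m) (there k) = x∈p─q⇒x∉q p q m k

x∈p-y⇒x≢y : ∀ {x y : Fin n} (p : Subset n) → x ∈ p - y → x ≢ y
x∈p-y⇒x≢y {y = y} p = x∉⁅y⁆⇒x≢y ∘ x∈p─q⇒x∉q p ⁅ y ⁆

x∉p⇒p-x≡p : ∀ {x : Fin n} {p : Subset n} → x ∉ p → p - x ≡ p
x∉p⇒p-x≡p {x = x} {p} x∉p =
  ⊆-antisym (p─q⊆p p ⁅ x ⁆) (λ y∈p → x∈p∧x≢y⇒x∈p-y y∈p (λ { refl → x∉p y∈p }))

x∉p⇒[p∪⁅x⁆]∩q-x≡p∩q : ∀ {x : Fin n} {p q : Subset n} → x ∉ p → (p ∪ ⁅ x ⁆) ∩ q - x ≡ p ∩ q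
x∉p⇒[p∪⁅x⁆]∩q-x≡p∩q {x = x} {p} {q} x∉p = ⊆-antisym forth back
  where
  forth : (p ∪ ⁅ x ⁆) ∩ q - x ⊆ p ∩ q
  forth {y} m with x∈p∩q⁻ _ _ (p─q⊆p _ ⁅ x ⁆ m)
  ... | y∈p∪x , y∈q with x∈p∪q⁻ p ⁅ x ⁆ y∈p∪x
  ... | inj₁ y∈p = x∈p∩q⁺ (y∈p , y∈q)
  ... | inj₂ y∈x = contradiction (x∈⁅y⁆⇒x≡y x y∈x) (x∈p-y⇒x≢y _ m)
  back : p ∩ q ⊆ (p ∪ ⁅ x ⁆) ∩ q - x
  back m with x∈p∩q⁻ p q m
  ... | y∈p , y∈q = x∈p∧x≢y⇒x∈p-y (x∈p∩q⁺ (p⊆p∪q _ y∈p , y∈q)) (λ { refl → x∉p y∈p })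

q⊆r⇒[p∩r-x]∩q≡p∩q-x : ∀ {x : Fin n} {p q r : Subset n} → q ⊆ r → (p ∩ r - x) ∩ q ≡ p ∩ q - x
q⊆r⇒[p∩r-x]∩q≡p∩q-x {x = x} {p} {q} {r} q⊆r = ⊆-antisym forth back
  where
  forth : (p ∩ r - x) ∩ q ⊆ p ∩ q - x
  forth m with x∈p∩q⁻ _ q m
  ... | y∈p∩r-x , y∈q =
    x∈p∧x≢y⇒x∈p-y (x∈p∩q⁺ (proj₁ (x∈p∩q⁻ p r (p─q⊆p _ ⁅ x ⁆ y∈p∩r-x)) , y∈q)) (x∈p-y⇒x≢y _ y∈p∩r-x)
  back : p ∩ q - x ⊆ (p ∩ r - x) ∩ q
  back m with x∈p∩q⁻ p q (p─q⊆p _ ⁅ x ⁆ m)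
  ... | y∈p , y∈q = x∈p∩q⁺ (x∈p∧x≢y⇒x∈p-y (x∈p∩q⁺ (y∈p , q⊆r y∈q)) (x∈p-y⇒x≢y _ m) , y∈q)

∣p∪q∣≤∣p∣+∣q∣ : ∀ (p q : Subset n) → ∣ p ∪ q ∣ ≤ ∣ p ∣ + ∣ q ∣
∣p∪q∣≤∣p∣+∣q∣ []            []            = z≤n
∣p∪q∣≤∣p∣+∣q∣ (inside  ∷ p) (s       ∷ q) =
  s≤s (≤-trans (∣p∪q∣≤∣p∣+∣q∣ p q) (+-monoʳ-≤ ∣ p ∣ (∣p∣≤∣x∷p∣ s q)))
∣p∪q∣≤∣p∣+∣q∣ (outside ∷ p) (inside  ∷ q) =
  ≤-trans (s≤s (∣p∪q∣≤∣p∣+∣q∣ p q)) (≤-reflexive (sym (+-suc ∣ p ∣ ∣ q ∣)))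
∣p∪q∣≤∣p∣+∣q∣ (outside ∷ p) (outside ∷ q) = ∣p∪q∣≤∣p∣+∣q∣ p q

infix 4 _≟ˢ_
_≟ˢ_ : (p q : Subset n) → Dec (p ≡ q)
_≟ˢ_ = ≡-dec _≟ᵇ_

least-upward-closed : {Q : ℕ → Set} → Decidable Q → (∀ {j k} → j ≤ k → Q j → Q k) →
                      ∀ m → Q m → ∃ λ k → Q k × (∀ j → Q j → k ≤ j)
least-upward-closed Q? up zero    q = zero , q , λ _ _ → z≤n
least-upward-closed Q? up (suc m) q with Q? m
... | yes qm = least-upward-closed Q? up m qm
... | no ¬qm = suc m , q , λ j qj → ≰⇒> (λ j≤m → ¬qm (up j≤m qj))

minimum-size : {P : Subset n → Set} → Decidable P → ∃ P →
               Σ ℕ λ k → Σ (Subset n) (λ C → P C × ∣ C ∣ ≡ k) × (∀ C → P C → k ≤ ∣ C ∣)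
minimum-size {P = P} P? (C₀ , pC₀) =
  tighten (least-upward-closed SizeAtMost? grow ∣ C₀ ∣ (C₀ , pC₀ , ≤-refl))
  where
  SizeAtMost : ℕ → Set
  SizeAtMost k = ∃ λ C → P C × ∣ C ∣ ≤ k
  SizeAtMost? : Decidable SizeAtMost
  SizeAtMost? k = anySubset? (λ C → P? C ×-dec (∣ C ∣ ≤? k))
  grow : ∀ {j k} → j ≤ k → SizeAtMost j → SizeAtMost k
  grow j≤k (C , pC , ∣C∣≤j) = C , pC , ≤-trans ∣C∣≤j j≤k
  tighten : (∃ λ k → SizeAtMost k × (∀ j → SizeAtMost j → k ≤ j)) →
            Σ ℕ λ k → Σ (Subset _) (λ C → P C × ∣ C ∣ ≡ k) × (∀ C → P C → k ≤ ∣ C ∣)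
  tighten (k , (C , pC , ∣C∣≤k) , least) =
    k , (C , pC , ≤-antisym ∣C∣≤k (least ∣ C ∣ (C , pC , ≤-refl))) ,
    λ C′ pC′ → least ∣ C′ ∣ (C′ , pC′ , ≤-refl)

module GraphCodes (G : Graph n) where

  v∉Nv : ∀ v → v ∉ N G v
  v∉Nv v v∈Nv = contradiction true≡false λ ()
    where
    true≡false : true ≡ false
    true≡false = trans (sym ([]=⇒lookup v∈Nv)) (trans (lookup∘tabulate (adj G v) v) (adj-irr G v))

  v∉Nv∩C : ∀ {C} v → v ∉ N G v ∩ C
  v∉Nv∩C v = v∉Nv v ∘ proj₁ ∘ x∈p∩q⁻ _ _

  fullSep⇒openSep : ∀ {C} → IsFullSeparating G C → IsOpenSeparating G C
  fullSep⇒openSep {C} full u v u≢v Nu∩C≡Nv∩C = full u v u≢v (begin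
    N G v ∩ C - u ≡⟨ cong (_- u) (sym Nu∩C≡Nv∩C) ⟩
    N G u ∩ C - u ≡⟨ x∉p⇒p-x≡p (v∉Nv∩C u) ⟩
    N G u ∩ C     ≡⟨ Nu∩C≡Nv∩C ⟩
    N G v ∩ C     ≡⟨ x∉p⇒p-x≡p (v∉Nv∩C v) ⟨
    N G v ∩ C - v ≡⟨ cong (_- v) (sym Nu∩C≡Nv∩C) ⟩
    N G u ∩ C - v ∎)

  fullSep⇒closedSep : ∀ {C} → IsFullSeparating G C → IsClosedSeparating G C
  fullSep⇒closedSep {C} full u v u≢v N[u]∩C≡N[v]∩C = full u v u≢v (begin
    N G v ∩ C - u          ≡⟨ cong (_- u) (N[v]∩C-v≡Nv∩C v) ⟨
    N[_] G v ∩ C - v - u  ≡⟨ cong (λ S → S - v - u) N[u]∩C≡N[v]∩C ⟨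
    N[_] G u ∩ C - v - u  ≡⟨ p─x─y≡p─y─x _ v u ⟩
    N[_] G u ∩ C - u - v  ≡⟨ cong (_- v) (N[v]∩C-v≡Nv∩C u) ⟩
    N G u ∩ C - v          ∎)
    where
    N[v]∩C-v≡Nv∩C : ∀ v → N[_] G v ∩ C - v ≡ N G v ∩ C
    N[v]∩C-v≡Nv∩C v = x∉p⇒[p∪⁅x⁆]∩q-x≡p∩q (v∉Nv v)

  openSep⇒locating : ∀ {C} → IsOpenSeparating G C → IsLocating G C
  openSep⇒locating open′ u v _ _ = open′ u v

  totalDom⇒dom : ∀ {C} → IsTotalDominating G C → IsDominating G C
  totalDom⇒dom total v =
    map₂ (λ m → let x∈N , x∈C = x∈p∩q⁻ _ _ m in x∈p∩q⁺ (p⊆p∪q _ x∈N , x∈C)) (total v)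

  fullSep-mono : ∀ {C C′} → C ⊆ C′ → IsFullSeparating G C → IsFullSeparating G C′
  fullSep-mono {C} {C′} C⊆C′ full u v u≢v traces′≡ = full u v u≢v (begin
    N G v ∩ C - u            ≡⟨ q⊆r⇒[p∩r-x]∩q≡p∩q-x C⊆C′ ⟨
    (N G v ∩ C′ - u) ∩ C    ≡⟨ cong (_∩ C) traces′≡ ⟩
    (N G u ∩ C′ - v) ∩ C    ≡⟨ q⊆r⇒[p∩r-x]∩q≡p∩q-x C⊆C′ ⟩
    N G u ∩ C - v            ∎)

  fullSep⇒undominated-unique : ∀ {C} → IsFullSeparating G C →
                               ∀ {u v} → Empty (N G u ∩ C) → Empty (N G v ∩ C) → u ≡ v
  fullSep⇒undominated-unique {C} full {u} {v} empty-u empty-v = decidable-stable (u ≟ᶠ v) λ u≢v →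
    full u v u≢v (trans (Empty-unique (empty-v ∘ map₂ (p─q⊆p _ _)))
                        (sym (Empty-unique (empty-u ∘ map₂ (p─q⊆p _ _)))))

  fullSep⇒FTD-with-one-more : (∀ v → Nonempty (N G v)) → ∀ {C} → IsFullSeparating G C →
                              ∃ λ C′ → IsCode FTD G C′ × ∣ C′ ∣ ≤ ∣ C ∣ + 1
  fullSep⇒FTD-with-one-more no-isolated {C} full with all? (λ v → nonempty? (N G v ∩ C))
  ... | yes total = C , (full , total) , m≤m+n ∣ C ∣ 1
  ... | no ¬total = extend (¬∀⟶∃¬ _ _ (λ v → nonempty? (N G v ∩ C)) ¬total)
    where
    extend : (∃ λ w → Empty (N G w ∩ C)) → ∃ λ C′ → IsCode FTD G C′ × ∣ C′ ∣ ≤ ∣ C ∣ + 1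
    extend (w , empty-w) = C ∪ ⁅ x ⁆ , (fullSep-mono (p⊆p∪q _) full , total) , size
      where
      x : Fin n
      x = proj₁ (no-isolated w)
      total : IsTotalDominating G (C ∪ ⁅ x ⁆)
      total v with nonempty? (N G v ∩ C)
      ... | yes dominated =
        map₂ (λ m → let y∈N , y∈C = x∈p∩q⁻ _ _ m in x∈p∩q⁺ (y∈N , p⊆p∪q _ y∈C)) dominated
      ... | no empty-v with refl ← fullSep⇒undominated-unique full empty-v empty-w =
        x , x∈p∩q⁺ (proj₂ (no-isolated w) , x∈p∪q⁺ (inj₂ (x∈⁅x⁆ x)))
      size : ∣ C ∪ ⁅ x ⁆ ∣ ≤ ∣ C ∣ + 1
      size = subst (λ k → ∣ C ∪ ⁅ x ⁆ ∣ ≤ ∣ C ∣ + k) (∣⁅x⁆∣≡1 x) (∣p∪q∣≤∣p∣+∣q∣ C ⁅ x ⁆)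

  dom? : Decidable (IsDominating G)
  dom? C = all? λ v → nonempty? (N[_] G v ∩ C)

  totalDom? : Decidable (IsTotalDominating G)
  totalDom? C = all? λ v → nonempty? (N G v ∩ C)

  closedSep? : Decidable (IsClosedSeparating G)
  closedSep? C = all? λ u → all? λ v → ¬? (u ≟ᶠ v) →-dec ¬? (N[_] G u ∩ C ≟ˢ N[_] G v ∩ C)

  openSep? : Decidable (IsOpenSeparating G)
  openSep? C = all? λ u → all? λ v → ¬? (u ≟ᶠ v) →-dec ¬? (N G u ∩ C ≟ˢ N G v ∩ C)

  locating? : Decidable (IsLocating G)
  locating? C = all? λ u → all? λ v →
    ¬? (u ∈? C) →-dec ¬? (v ∈? C) →-dec ¬? (u ≟ᶠ v) →-dec ¬? (N G u ∩ C ≟ˢ N G v ∩ C)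

  fullSep? : Decidable (IsFullSeparating G)
  fullSep? C = all? λ u → all? λ v → ¬? (u ≟ᶠ v) →-dec ¬? (N G v ∩ C - u ≟ˢ N G u ∩ C - v)

  IsCode? : ∀ X → Decidable (IsCode X G)
  IsCode? ID  C = closedSep? C ×-dec dom? C
  IsCode? ITD C = closedSep? C ×-dec totalDom? C
  IsCode? LTD C = locating? C ×-dec totalDom? C
  IsCode? OD  C = openSep? C ×-dec dom? C
  IsCode? OTD C = openSep? C ×-dec totalDom? C
  IsCode? FD  C = fullSep? C ×-dec dom? C
  IsCode? FTD C = fullSep? C ×-dec totalDom? C

  γ-exists : ∀ X → HasCode X G → Σ ℕ (IsGamma X G)
  γ-exists X = minimum-size (IsCode? X)

  γ-mono : ∀ X Y {a b} → (∀ {C} → IsCode Y G C → IsCode X G C) →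
           IsGamma X G a → IsGamma Y G b → a ≤ b
  γ-mono _ _ Y⇒X (_ , minimal) ((C , c , refl) , _) = minimal C (Y⇒X c)

  γ-∸1-mono : ∀ X Y {a b} → (∀ {C} → IsCode Y G C → ∃ λ C′ → IsCode X G C′ × ∣ C′ ∣ ≤ ∣ C ∣ + 1) →
              IsGamma X G a → IsGamma Y G b → a ∸ 1 ≤ b
  γ-∸1-mono _ _ {a} Y⇒X+1 (_ , minimal) ((C , c , refl) , _) with C′ , c′ , ∣C′∣≤ ← Y⇒X+1 c =
    subst (a ∸ 1 ≤_) (m+n∸n≡m ∣ C ∣ 1) (∸-monoˡ-≤ 1 (≤-trans (minimal C′ c′) ∣C′∣≤))

  FTD⇒FD : ∀ {C} → IsCode FTD G C → IsCode FD G C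
  FTD⇒FD (full , total) = full , totalDom⇒dom total

  FTD⇒ITD : ∀ {C} → IsCode FTD G C → IsCode ITD G C
  FTD⇒ITD (full , total) = fullSep⇒closedSep full , total

  FTD⇒OTD : ∀ {C} → IsCode FTD G C → IsCode OTD G C
  FTD⇒OTD (full , total) = fullSep⇒openSep full , total

  FTD⇒LTD : ∀ {C} → IsCode FTD G C → IsCode LTD G C
  FTD⇒LTD (full , total) = openSep⇒locating (fullSep⇒openSep full) , total

  FD⇒ID : ∀ {C} → IsCode FD G C → IsCode ID G C
  FD⇒ID (full , dom) = fullSep⇒closedSep full , dom

  FD⇒OD : ∀ {C} → IsCode FD G C → IsCode OD G C
  FD⇒OD (full , dom) = fullSep⇒openSep full , dom

corollary4 : {n : ℕ} (G : Graph n) → HasCode FTD G →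
    Σ ℕ (λ gID → Σ ℕ (λ gITD → Σ ℕ (λ gLTD → Σ ℕ (λ gOD → Σ ℕ (λ gOTD → Σ ℕ (λ gFD → Σ ℕ (λ gFTD →
      (IsGamma ID G gID × IsGamma ITD G gITD × IsGamma LTD G gLTD × IsGamma OD G gOD
        × IsGamma OTD G gOTD × IsGamma FD G gFD × IsGamma FTD G gFTD)
      × (gITD ⊔ (gOTD ⊔ gFD) ≤ gFTD)
      × (gID ⊔ (gOD ⊔ ((gLTD ∸ 1) ⊔ ((gITD ∸ 1) ⊔ (gOTD ∸ 1)))) ≤ gFD))))))))
corollary4 G hasFTD@(_ , _ , total₀) =
  let gID  , γID  = γ-from-FTD ID  (FD⇒ID ∘ FTD⇒FD)
      gITD , γITD = γ-from-FTD ITD FTD⇒ITD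
      gLTD , γLTD = γ-from-FTD LTD FTD⇒LTD
      gOD  , γOD  = γ-from-FTD OD  (FD⇒OD ∘ FTD⇒FD)
      gOTD , γOTD = γ-from-FTD OTD FTD⇒OTD
      gFD  , γFD  = γ-from-FTD FD  FTD⇒FD
      gFTD , γFTD = γ-from-FTD FTD (λ c → c)
  in gID , gITD , gLTD , gOD , gOTD , gFD , gFTD ,
     (γID , γITD , γLTD , γOD , γOTD , γFD , γFTD) ,
     ⊔-lub (γ-mono ITD FTD FTD⇒ITD γITD γFTD)
       (⊔-lub (γ-mono OTD FTD FTD⇒OTD γOTD γFTD)
              (γ-mono FD FTD FTD⇒FD γFD γFTD)) ,
     ⊔-lub (γ-mono ID FD FD⇒ID γID γFD)
       (⊔-lub (γ-mono OD FD FD⇒OD γOD γFD)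
         (⊔-lub (γ-∸1-mono LTD FD (FD⇒+1 LTD FTD⇒LTD) γLTD γFD)
           (⊔-lub (γ-∸1-mono ITD FD (FD⇒+1 ITD FTD⇒ITD) γITD γFD)
                  (γ-∸1-mono OTD FD (FD⇒+1 OTD FTD⇒OTD) γOTD γFD))))
  where
  open GraphCodes G

  γ-from-FTD : ∀ X → (∀ {C} → IsCode FTD G C → IsCode X G C) → Σ ℕ (IsGamma X G)
  γ-from-FTD X FTD⇒X = γ-exists X (map₂ FTD⇒X hasFTD)

  FD⇒+1 : ∀ X → (∀ {C} → IsCode FTD G C → IsCode X G C) →
          ∀ {C} → IsCode FD G C → ∃ λ C′ → IsCode X G C′ × ∣ C′ ∣ ≤ ∣ C ∣ + 1
  FD⇒+1 _ FTD⇒X (full , _) = map₂ (map₁ FTD⇒X) (fullSep⇒FTD-with-one-more no-isolated full)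
    where
    no-isolated : ∀ v → Nonempty (N G v)
    no-isolated v = map₂ (proj₁ ∘ x∈p∩q⁻ _ _) (total₀ v)
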